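{- Let $G$ be an additive abelian group of order $n$ and suppose $\{A_1,\dots,A_m\}$ is an $(n,m;k_1,\dots,k_m;\lambda_1,\dots,\lambda_m)$-generalized strong external difference family in $G$, where $m\geq 3$. Let $\Lambda=\lambda_1+\cdots+\lambda_m$ and $K=k_1+\cdots+k_m$. Then for any $i\in\{1,\dots,m\}$ for which $k_i>\lambda_i>1$ and $\lambda_i\leq \frac{\Lambda}{2}$, \[ \frac{(k_i-1)(\Lambda-2\lambda_i)}{(K-k_i)(\lambda_i-1)}\leq 1. \]
   Context: For disjoint subsets $A,B$ of an additive abelian group $G$, let $\mathcal{D}(A,B)$ denote the multiset $\{x-y : x\in A,\ y\in B\}$. An $(n,m;k_1,\dots,k_m;\lambda_1,\dots,\lambda_m)$-generalized strong external difference family (GSEDF) in an additive abelian group $G$ of order $n$ is a set of $m$ pairwise disjoint subsets $A_1,\dots,A_m$ of $G$ with $|A_i|=k_i$ for $1\le i\le m$, such that for every $i$ the multiset union $\bigcup_{j\neq i}\mathcal{D}(A_i,A_j)$ contains every nonzero element of $G$ exactly $\lambda_i$ times. -}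

module Defs where

open import Level using (Level)
open import Algebra.Bundles using (AbelianGroup)
open import Data.Nat using (ℕ)
open import Data.Fin using (Fin; _≟_)
open import Data.Fin.Subset using (Subset; _∈_; ∣_∣)
open import Data.Fin.Subset.Properties using (_∈?_)
open import Data.List using (List; length; filter; cartesianProduct; allFin; map)
open import Data.Nat.ListAction using (sum)
import Data.Empty
open import Data.Product using (_×_; _,_; Σ; proj₁; proj₂)
open import Relation.Nullary using (¬_; Dec)
open import Relation.Nullary.Decidable using (_×-dec_; ¬?)
open import Relation.Binary using (Decidable)
open import Relation.Binary.PropositionalEquality using (_≡_; _≢_)

record FiniteAbelianGroup {c ℓ : Level} (G : AbelianGroup c ℓ) (n : ℕ) : Set (c Level.⊔ ℓ) where
  open AbelianGroup G
  field
    elem       : Fin n → Carrier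
    elem-inj   : ∀ a b → elem a ≈ elem b → a ≡ b
    elem-surj  : ∀ x → Σ (Fin n) (λ a → elem a ≈ x)
    _≈?_       : Decidable _≈_

module _ {c ℓ : Level} {G : AbelianGroup c ℓ} {n : ℕ} (F : FiniteAbelianGroup G n) where
  open AbelianGroup G renaming (_∙_ to _+_; _⁻¹ to -_; ε to 0#)
  open FiniteAbelianGroup F

  -- Subsets of G are represented as subsets of the index set Fin n via `elem`.
  -- Multiplicity of g in the multiset D(A,B) = { x - y : x ∈ A, y ∈ B }.
  diffMult : Subset n → Subset n → Carrier → ℕ
  diffMult A B g =
    length (filter (λ p → (proj₁ p ∈? A) ×-dec ((proj₂ p ∈? B) ×-dec
                          ((elem (proj₁ p) + (- elem (proj₂ p))) ≈? g)))
                   (cartesianProduct (allFin n) (allFin n)))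

  record IsGSEDF (m : ℕ) (A : Fin m → Subset n) (k λ' : Fin m → ℕ) : Set (c Level.⊔ ℓ) where
    field
      disjoint : ∀ i j → i ≢ j → ∀ x → x ∈ A i → x ∈ A j → Data.Empty.⊥
      sizes    : ∀ i → ∣ A i ∣ ≡ k i
      diffs    : ∀ i (g : Carrier) → ¬ (g ≈ 0#) →
                 sum (map (λ j → diffMult (A i) (A j) g)
                          (filter (λ j → ¬? (j ≟ i)) (allFin m))) ≡ λ' i

Σ[_] : ∀ {m} → (Fin m → ℕ) → ℕ
Σ[ f ] = sum (map f (allFin _))

-- Fix a ∈ A_i.  For d ≠ 0, the representations of d as a difference between two
-- blocks A_l, A_j with l, j ≠ i number 𝒳(d) = Λ − 2λ_i: each λ_l (l ≠ i) loses
-- exactly its part 𝒟(A_l,A_i)(d), and these parts add up to λ_i.  Summing 𝒳(a − a')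
-- over a' ∈ A_i∖{a} therefore gives (k_i − 1)(Λ − 2λ_i).  Grouping the same
-- configurations by the element b ∈ A_l (l ≠ i) instead, the remaining data (j, a', c)
-- satisfy a' − c = a − b, so they are among the λ_i representations of a − b from A_i;
-- the representation (l, a, b) itself never occurs, so each of the K − k_i choices of b
-- contributes at most λ_i − 1.

module Submission where

open import Defs
open import Level using (Level)
open import Algebra.Bundles using (AbelianGroup)
open import Data.Bool using (true; false; if_then_else_)
open import Data.Nat using (ℕ; zero; suc; _≤_; _<_; _∸_; _*_; _+_; z≤n; z<s)
open import Data.Nat.Properties hiding (_≟_)
open import Data.Fin using (Fin; zero; suc; _≟_)
open import Data.Fin.Subset using (Subset; _∈_; ∣_∣; inside; outside)
open import Data.Fin.Subset.Properties using (_∈?_)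
open import Data.List using (List; []; _∷_; _++_; map; filter; length; tabulate; allFin; cartesianProduct)
import Data.Nat.ListAction as List
open import Data.Nat.ListAction.Properties using (sum-++)
open import Data.List.Properties using (map-++; map-∘)
open import Data.Vec using ([]; _∷_)
open import Data.Product using (_×_; _,_; ∃; proj₁; proj₂)
open import Relation.Nullary using (¬_; Dec; yes; no; does; contradiction)
open import Relation.Nullary.Decidable using (_×-dec_; ¬?)
open import Relation.Binary.PropositionalEquality using (_≡_; _≢_; refl; sym; trans; cong; cong₂; ≢-sym; module ≡-Reasoning)
open import Function using (_∘_)
open import Algebra.Properties.Semiring.Sum +-*-semiring
  using (sum; sum-syntax; sum-cong-≗; ∑-comm; ∑-distrib-+; *-distribˡ-sum; *-distribʳ-sum)
open import Algebra.Properties.CommutativeSemigroup +-commutativeSemigroup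
  using () renaming (x∙yz≈y∙xz to x+[y+z]≡y+[x+z])
open import Algebra.Properties.CommutativeSemigroup *-commutativeSemigroup
  using () renaming (x∙yz≈y∙xz to x*[y*z]≡y*[x*z])

private
  variable
    p q : Level
    P : Set p
    Q : Set q
    n : ℕ
    A B : Set p

⟦_⟧ : Dec P → ℕ
⟦ P? ⟧ = if does P? then 1 else 0

⟦⟧-yes : (P? : Dec P) → P → ⟦ P? ⟧ ≡ 1
⟦⟧-yes (yes _) _ = refl
⟦⟧-yes (no ¬p) p = contradiction p ¬p

⟦⟧-no : (P? : Dec P) → ¬ P → ⟦ P? ⟧ ≡ 0
⟦⟧-no (yes p) ¬p = contradiction p ¬p
⟦⟧-no (no _)  _  = refl

⟦⟧≤1 : (P? : Dec P) → ⟦ P? ⟧ ≤ 1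
⟦⟧≤1 (yes _) = ≤-refl
⟦⟧≤1 (no _)  = z≤n

⟦⟧>0⇒ : (P? : Dec P) → 0 < ⟦ P? ⟧ → P
⟦⟧>0⇒ (yes p) _ = p

⟦⟧-mono : (P? : Dec P) (Q? : Dec Q) → (P → Q) → ⟦ P? ⟧ ≤ ⟦ Q? ⟧
⟦⟧-mono (yes p) Q? P⇒Q = ≤-reflexive (sym (⟦⟧-yes Q? (P⇒Q p)))
⟦⟧-mono (no _)  Q? _   = z≤n

⟦⟧-cong : (P? : Dec P) (Q? : Dec Q) → (P → Q) → (Q → P) → ⟦ P? ⟧ ≡ ⟦ Q? ⟧
⟦⟧-cong P? Q? P⇒Q Q⇒P = ≤-antisym (⟦⟧-mono P? Q? P⇒Q) (⟦⟧-mono Q? P? Q⇒P)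

⟦×-dec⟧ : (P? : Dec P) (Q? : Dec Q) → ⟦ P? ×-dec Q? ⟧ ≡ ⟦ P? ⟧ * ⟦ Q? ⟧
⟦×-dec⟧ (yes _) (yes _) = refl
⟦×-dec⟧ (yes _) (no _)  = refl
⟦×-dec⟧ (no _)  _       = refl

⟦⟧*≤ : (P? : Dec P) (x : ℕ) → ⟦ P? ⟧ * x ≤ x
⟦⟧*≤ P? x = ≤-trans (*-monoˡ-≤ x (⟦⟧≤1 P?)) (≤-reflexive (*-identityˡ x))

*⟦⟧≤ : (x : ℕ) (P? : Dec P) → x * ⟦ P? ⟧ ≤ x
*⟦⟧≤ x P? = ≤-trans (*-monoʳ-≤ x (⟦⟧≤1 P?)) (≤-reflexive (*-identityʳ x))

[_≢_] : Fin n → Fin n → ℕ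
[ x ≢ y ] = ⟦ ¬? (x ≟ y) ⟧

[_∈_] : Fin n → Subset n → ℕ
[ x ∈ p ] = ⟦ x ∈? p ⟧

[≢]-refl : (x : Fin n) → [ x ≢ x ] ≡ 0
[≢]-refl x = ⟦⟧-no (¬? (x ≟ x)) (λ x≢x → x≢x refl)

[≢]>0⇒≢ : {x y : Fin n} → 0 < [ x ≢ y ] → x ≢ y
[≢]>0⇒≢ {x = x} {y} = ⟦⟧>0⇒ (¬? (x ≟ y))

*-cong-supp : ∀ w {x y} → (0 < w → x ≡ y) → w * x ≡ w * y
*-cong-supp zero    _  = refl
*-cong-supp (suc w) eq = cong (suc w *_) (eq z<s)

*-mono-supp : ∀ w {x y} → (0 < w → x ≤ y) → w * x ≤ w * y
*-mono-supp zero    _  = z≤n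
*-mono-supp (suc w) le = *-monoʳ-≤ (suc w) (le z<s)

*-pos-inv : ∀ x y → 0 < x * y → 0 < x × 0 < y
*-pos-inv (suc x) zero    pos = contradiction (*-zeroʳ (suc x)) (m<n⇒n≢0 pos)
*-pos-inv (suc x) (suc y) _   = z<s , z<s

<⇒≤∸1 : ∀ {x y} → x < y → x ≤ y ∸ 1
<⇒≤∸1 {y = y} x<y = ≤-trans (<⇒≤pred x<y) (≤-reflexive (pred[m∸n]≡m∸[1+n] y 0))

∑-mono-≤ : {f g : Fin n → ℕ} → (∀ x → f x ≤ g x) → sum f ≤ sum g
∑-mono-≤ {zero}  le = z≤n
∑-mono-≤ {suc n} le = +-mono-≤ (le zero) (∑-mono-≤ (le ∘ suc))

∑-cong-supp : (w f g : Fin n → ℕ) → (∀ x → 0 < w x → f x ≡ g x) →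
              ∑[ x < n ] (w x * f x) ≡ ∑[ x < n ] (w x * g x)
∑-cong-supp w f g eq = sum-cong-≗ (λ x → *-cong-supp (w x) (eq x))

∑-mono-supp : (w f g : Fin n → ℕ) → (∀ x → 0 < w x → f x ≤ g x) →
              ∑[ x < n ] (w x * f x) ≤ ∑[ x < n ] (w x * g x)
∑-mono-supp w f g le = ∑-mono-≤ (λ x → *-mono-supp (w x) (le x))

∑-split : (f : Fin n → ℕ) (c : Fin n) → sum f ≡ f c + ∑[ x < n ] ([ x ≢ c ] * f x)
∑-split {suc n} f zero = cong (f zero +_) (sum-cong-≗ (λ x → sym (*-identityˡ (f (suc x)))))
∑-split {suc n} f (suc c) = begin
  f zero + sum (f ∘ suc)              ≡⟨ cong (f zero +_) (∑-split (f ∘ suc) c) ⟩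
  f zero + (f (suc c) + rest)         ≡⟨ x+[y+z]≡y+[x+z] (f zero) (f (suc c)) rest ⟩
  f (suc c) + (f zero + rest)         ≡⟨ cong (λ t → f (suc c) + (t + rest)) (*-identityˡ (f zero)) ⟨
  f (suc c) + (1 * f zero + rest)     ∎
  where
  open ≡-Reasoning
  rest = ∑[ x < n ] ([ x ≢ c ] * f (suc x))

∑-≢ : (f : Fin n → ℕ) (c : Fin n) → ∑[ x < n ] ([ x ≢ c ] * f x) ≡ sum f ∸ f c
∑-≢ f c = sym (trans (cong (_∸ f c) (∑-split f c)) (m+n∸m≡n (f c) _))

≤∑ : (f : Fin n → ℕ) (c : Fin n) → f c ≤ sum f
≤∑ f c = ≤-trans (m≤m+n (f c) _) (≤-reflexive (sym (∑-split f c)))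

∑-mono-< : {f g : Fin n → ℕ} (c : Fin n) → (∀ x → f x ≤ g x) → f c < g c → sum f < sum g
∑-mono-< {f = f} {g} c le lt = begin-strict
  sum f                                 ≡⟨ ∑-split f c ⟩
  f c + ∑[ x < _ ] ([ x ≢ c ] * f x)    <⟨ +-mono-<-≤ lt (∑-mono-≤ (λ x → *-monoʳ-≤ [ x ≢ c ] (le x))) ⟩
  g c + ∑[ x < _ ] ([ x ≢ c ] * g x)    ≡⟨ ∑-split g c ⟨
  sum g                                 ∎
  where open ≤-Reasoning

∑>0⇒∃ : (f : Fin n → ℕ) → 0 < sum f → ∃ λ x → 0 < f x
∑>0⇒∃ {suc n} f pos with f zero in eq
... | suc _ = zero , ≤-trans z<s (≤-reflexive (sym eq))
... | zero  = let x , fx>0 = ∑>0⇒∃ (f ∘ suc) pos in suc x , fx>0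

∑-*-comm : (f : Fin n → ℕ) {k : ℕ} (g : Fin k → ℕ) (h : Fin n → Fin k → ℕ) →
           ∑[ x < n ] (f x * ∑[ y < k ] (g y * h x y)) ≡ ∑[ y < k ] (g y * ∑[ x < n ] (f x * h x y))
∑-*-comm {n} f {k} g h = begin
  ∑[ x < n ] (f x * ∑[ y < k ] (g y * h x y))    ≡⟨ sum-cong-≗ (λ x → *-distribˡ-sum (f x) (λ y → g y * h x y)) ⟩
  ∑[ x < n ] ∑[ y < k ] (f x * (g y * h x y))    ≡⟨ ∑-comm (λ x y → f x * (g y * h x y)) ⟩
  ∑[ y < k ] ∑[ x < n ] (f x * (g y * h x y))    ≡⟨ sum-cong-≗ (λ y → sum-cong-≗ (λ x → x*[y*z]≡y*[x*z] (f x) (g y) (h x y))) ⟩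
  ∑[ y < k ] ∑[ x < n ] (g y * (f x * h x y))    ≡⟨ sum-cong-≗ (λ y → *-distribˡ-sum (g y) (λ x → f x * h x y)) ⟨
  ∑[ y < k ] (g y * ∑[ x < n ] (f x * h x y))    ∎
  where open ≡-Reasoning

sum-map-tabulate : (f : A → ℕ) (g : Fin n → A) → List.sum (map f (tabulate g)) ≡ ∑[ x < n ] f (g x)
sum-map-tabulate {n = zero}  f g = refl
sum-map-tabulate {n = suc n} f g = cong (f (g zero) +_) (sum-map-tabulate f (g ∘ suc))

Σ[]≡∑ : (f : Fin n → ℕ) → Σ[ f ] ≡ sum f
Σ[]≡∑ f = sum-map-tabulate f (λ x → x)

length-filter : {P : A → Set q} (P? : ∀ x → Dec (P x)) (xs : List A) →
                length (filter P? xs) ≡ List.sum (map (λ x → ⟦ P? x ⟧) xs)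
length-filter P? []       = refl
length-filter P? (x ∷ xs) with does (P? x)
... | true  = cong suc (length-filter P? xs)
... | false = length-filter P? xs

sum-map-filter : {P : A → Set q} (P? : ∀ x → Dec (P x)) (f : A → ℕ) (xs : List A) →
                 List.sum (map f (filter P? xs)) ≡ List.sum (map (λ x → ⟦ P? x ⟧ * f x) xs)
sum-map-filter P? f []       = refl
sum-map-filter P? f (x ∷ xs) with does (P? x)
... | true  = cong₂ _+_ (sym (+-identityʳ (f x))) (sum-map-filter P? f xs)
... | false = sum-map-filter P? f xs

sum-map-cartesianProduct : (h : A × B → ℕ) (xs : List A) (ys : List B) →
                           List.sum (map h (cartesianProduct xs ys))
                             ≡ List.sum (map (λ x → List.sum (map (λ y → h (x , y)) ys)) xs)
sum-map-cartesianProduct h []       ys = refl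
sum-map-cartesianProduct h (x ∷ xs) ys = begin
  List.sum (map h (map (x ,_) ys ++ cartesianProduct xs ys))
    ≡⟨ cong List.sum (map-++ h (map (x ,_) ys) (cartesianProduct xs ys)) ⟩
  List.sum (map h (map (x ,_) ys) ++ map h (cartesianProduct xs ys))
    ≡⟨ sum-++ (map h (map (x ,_) ys)) (map h (cartesianProduct xs ys)) ⟩
  List.sum (map h (map (x ,_) ys)) + List.sum (map h (cartesianProduct xs ys))
    ≡⟨ cong₂ _+_ (cong List.sum (sym (map-∘ ys))) (sum-map-cartesianProduct h xs ys) ⟩
  List.sum (map (λ y → h (x , y)) ys) + List.sum (map (λ x → List.sum (map (λ y → h (x , y)) ys)) xs)
    ∎
  where open ≡-Reasoning

∣p∣≡∑[∈] : (p : Subset n) → ∣ p ∣ ≡ ∑[ x < n ] [ x ∈ p ]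
∣p∣≡∑[∈] []            = refl
∣p∣≡∑[∈] (inside  ∷ p) = cong suc (∣p∣≡∑[∈] p)
∣p∣≡∑[∈] (outside ∷ p) = ∣p∣≡∑[∈] p

module _ {c ℓ} (G : AbelianGroup c ℓ) where
  open AbelianGroup G
  open import Relation.Binary.Reasoning.Setoid setoid
  open import Algebra.Properties.AbelianGroup G using (⁻¹-anti-homo‿-; ⁻¹-injective; ε⁻¹≈ε)

  -‿telescope : ∀ x y z → (x - y) ∙ (y - z) ≈ x - z
  -‿telescope x y z = begin
    (x - y) ∙ (y - z)     ≈⟨ assoc x (y ⁻¹) (y - z) ⟩
    x ∙ (y ⁻¹ ∙ (y - z))  ≈⟨ ∙-congˡ (assoc (y ⁻¹) y (z ⁻¹)) ⟨
    x ∙ (y ⁻¹ ∙ y ∙ z ⁻¹) ≈⟨ ∙-congˡ (∙-congʳ (inverseˡ y)) ⟩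
    x ∙ (ε ∙ z ⁻¹)        ≈⟨ ∙-congˡ (identityˡ (z ⁻¹)) ⟩
    x - z                 ∎

  -‿exchange : ∀ {x y z w} → x - y ≈ z - w → w - y ≈ z - x
  -‿exchange {x} {y} {z} {w} eq = begin
    w - y             ≈⟨ -‿telescope w x y ⟨
    (w - x) ∙ (x - y) ≈⟨ ∙-congˡ eq ⟩
    (w - x) ∙ (z - w) ≈⟨ comm (w - x) (z - w) ⟩
    (z - w) ∙ (w - x) ≈⟨ -‿telescope z w x ⟩
    z - x             ∎

  ⁻¹-≉ε : ∀ {g} → ¬ g ≈ ε → ¬ g ⁻¹ ≈ ε
  ⁻¹-≉ε {g} g≉ε g⁻¹≈ε = g≉ε (⁻¹-injective (begin
    g ⁻¹ ≈⟨ g⁻¹≈ε ⟩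
    ε    ≈⟨ ε⁻¹≈ε ⟨
    ε ⁻¹ ∎))

  -‿swap : ∀ {x y g} → x - y ≈ g → y - x ≈ g ⁻¹
  -‿swap {x} {y} {g} eq = begin
    y - x       ≈⟨ ⁻¹-anti-homo‿- x y ⟨
    (x - y) ⁻¹  ≈⟨ ⁻¹-cong eq ⟩
    g ⁻¹        ∎

module GSEDF {c ℓ} {G : AbelianGroup c ℓ} {n : ℕ} (F : FiniteAbelianGroup G n)
  {m : ℕ} {A : Fin m → Subset n} {k λ' : Fin m → ℕ} (H : IsGSEDF F m A k λ') where

  open AbelianGroup G using (Carrier; _≈_; _-_; _⁻¹; ε)
  open import Algebra.Properties.AbelianGroup G using (x∙y⁻¹≈ε⇒x≈y; ⁻¹-involutive)
  open FiniteAbelianGroup F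
  open IsGSEDF H

  [_-_≈_] : Fin n → Fin n → Carrier → ℕ
  [ x - y ≈ g ] = ⟦ (elem x - elem y) ≈? g ⟧

  𝒟 : Fin m → Fin m → Carrier → ℕ
  𝒟 j l g = ∑[ x < n ] ([ x ∈ A j ] * ∑[ y < n ] ([ y ∈ A l ] * [ x - y ≈ g ]))

  diffMult≡𝒟 : ∀ j l g → diffMult F (A j) (A l) g ≡ 𝒟 j l g
  diffMult≡𝒟 j l g = begin
    diffMult F (A j) (A l) g
      ≡⟨ length-filter pair? (cartesianProduct (allFin n) (allFin n)) ⟩
    List.sum (map (λ xy → ⟦ pair? xy ⟧) (cartesianProduct (allFin n) (allFin n)))
      ≡⟨ sum-map-cartesianProduct (λ xy → ⟦ pair? xy ⟧) (allFin n) (allFin n) ⟩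
    List.sum (map (λ x → List.sum (map (λ y → ⟦ pair? (x , y) ⟧) (allFin n))) (allFin n))
      ≡⟨ Σ[]≡∑ (λ x → List.sum (map (λ y → ⟦ pair? (x , y) ⟧) (allFin n))) ⟩
    ∑[ x < n ] List.sum (map (λ y → ⟦ pair? (x , y) ⟧) (allFin n))
      ≡⟨ sum-cong-≗ (λ x → trans (Σ[]≡∑ (λ y → ⟦ pair? (x , y) ⟧)) (row-count x)) ⟩
    𝒟 j l g ∎
    where
    open ≡-Reasoning
    pair? : (xy : Fin n × Fin n) → Dec (proj₁ xy ∈ A j × (proj₂ xy ∈ A l × (elem (proj₁ xy) - elem (proj₂ xy)) ≈ g))
    pair? (x , y) = (x ∈? A j) ×-dec ((y ∈? A l) ×-dec ((elem x - elem y) ≈? g))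
    row-count : ∀ x → ∑[ y < n ] ⟦ pair? (x , y) ⟧ ≡ [ x ∈ A j ] * ∑[ y < n ] ([ y ∈ A l ] * [ x - y ≈ g ])
    row-count x = trans
      (sum-cong-≗ (λ y → trans (⟦×-dec⟧ (x ∈? A j) ((y ∈? A l) ×-dec ((elem x - elem y) ≈? g)))
                                 (cong ([ x ∈ A j ] *_) (⟦×-dec⟧ (y ∈? A l) ((elem x - elem y) ≈? g)))))
      (sym (*-distribˡ-sum [ x ∈ A j ] (λ y → [ y ∈ A l ] * [ x - y ≈ g ])))

  ∑𝒟≡λ : ∀ j {g} → ¬ g ≈ ε → ∑[ l < m ] ([ l ≢ j ] * 𝒟 j l g) ≡ λ' j
  ∑𝒟≡λ j {g} g≉ε = begin
    ∑[ l < m ] ([ l ≢ j ] * 𝒟 j l g)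
      ≡⟨ sum-cong-≗ (λ l → cong ([ l ≢ j ] *_) (diffMult≡𝒟 j l g)) ⟨
    ∑[ l < m ] ([ l ≢ j ] * diffMult F (A j) (A l) g)
      ≡⟨ Σ[]≡∑ (λ l → [ l ≢ j ] * diffMult F (A j) (A l) g) ⟨
    List.sum (map (λ l → [ l ≢ j ] * diffMult F (A j) (A l) g) (allFin m))
      ≡⟨ sum-map-filter (λ l → ¬? (l ≟ j)) (λ l → diffMult F (A j) (A l) g) (allFin m) ⟨
    List.sum (map (λ l → diffMult F (A j) (A l) g) (filter (λ l → ¬? (l ≟ j)) (allFin m)))
      ≡⟨ diffs j g g≉ε ⟩
    λ' j ∎
    where open ≡-Reasoning

  ∑[∈]≡k : ∀ j → ∑[ x < n ] [ x ∈ A j ] ≡ k j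
  ∑[∈]≡k j = trans (sym (∣p∣≡∑[∈] (A j))) (sizes j)

  ∑[≢∈]≡k∸1 : ∀ {j a} → a ∈ A j → ∑[ x < n ] ([ x ≢ a ] * [ x ∈ A j ]) ≡ k j ∸ 1
  ∑[≢∈]≡k∸1 {j} {a} a∈ = begin
    ∑[ x < n ] ([ x ≢ a ] * [ x ∈ A j ]) ≡⟨ ∑-≢ (λ x → [ x ∈ A j ]) a ⟩
    sum (λ x → [ x ∈ A j ]) ∸ [ a ∈ A j ] ≡⟨ cong₂ _∸_ (∑[∈]≡k j) (⟦⟧-yes (a ∈? A j) a∈) ⟩
    k j ∸ 1                               ∎
    where open ≡-Reasoning

  ∑[≢]k≡K∸k : ∀ i → ∑[ l < m ] ([ l ≢ i ] * k l) ≡ Σ[ k ] ∸ k i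
  ∑[≢]k≡K∸k i = trans (∑-≢ k i) (cong (_∸ k i) (sym (Σ[]≡∑ k)))

  ∃-∈ : ∀ j → 0 < k j → ∃ λ a → a ∈ A j
  ∃-∈ j k>0 =
    let a , pos = ∑>0⇒∃ (λ x → [ x ∈ A j ]) (≤-trans k>0 (≤-reflexive (sym (∑[∈]≡k j))))
    in a , ⟦⟧>0⇒ (a ∈? A j) pos

  ∃-≢ : ∀ {j a} → a ∈ A j → 1 < k j → ∃ λ a' → a' ≢ a
  ∃-≢ {j} {a} a∈ k>1 =
    let a' , pos = ∑>0⇒∃ (λ x → [ x ≢ a ] * [ x ∈ A j ])
                          (≤-trans (m<n⇒0<n∸m k>1) (≤-reflexive (sym (∑[≢∈]≡k∸1 a∈))))
    in a' , [≢]>0⇒≢ (proj₁ (*-pos-inv [ a' ≢ a ] [ a' ∈ A j ] pos))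

  -≉ε : ∀ {x y} → x ≢ y → ¬ elem x - elem y ≈ ε
  -≉ε {x} {y} x≢y x-y≈ε = x≢y (elem-inj x y (x∙y⁻¹≈ε⇒x≈y (elem x) (elem y) x-y≈ε))

  𝒟-swap : ∀ j l g → 𝒟 j l g ≡ 𝒟 l j (g ⁻¹)
  𝒟-swap j l g = trans
    (∑-*-comm (λ x → [ x ∈ A j ]) (λ y → [ y ∈ A l ]) (λ x y → [ x - y ≈ g ]))
    (sum-cong-≗ λ y → cong ([ y ∈ A l ] *_) (sum-cong-≗ λ x → cong ([ x ∈ A j ] *_)
      (⟦⟧-cong ((elem x - elem y) ≈? g) ((elem y - elem x) ≈? (g ⁻¹))
        (-‿swap G)
        (λ eq → AbelianGroup.trans G (-‿swap G eq) (⁻¹-involutive g)))))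

  𝒟-pos : ∀ {j l x y} → x ∈ A j → y ∈ A l → 0 < 𝒟 j l (elem x - elem y)
  𝒟-pos {j} {l} {x} {y} x∈ y∈ = begin-strict
    0                                    <⟨ z<s ⟩
    1                                    ≡⟨ cong₂ _*_ (⟦⟧-yes (x ∈? A j) x∈) (cong₂ _*_ (⟦⟧-yes (y ∈? A l) y∈) x-y≈g) ⟨
    [ x ∈ A j ] * summand x y            ≤⟨ *-monoʳ-≤ [ x ∈ A j ] (≤∑ (summand x) y) ⟩
    [ x ∈ A j ] * ∑[ y' < n ] summand x y' ≤⟨ ≤∑ (λ x' → [ x' ∈ A j ] * ∑[ y' < n ] summand x' y') x ⟩
    𝒟 j l g                              ∎
    where
    open ≤-Reasoning
    g = elem x - elem y
    summand : Fin n → Fin n → ℕ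
    summand x' y' = [ y' ∈ A l ] * [ x' - y' ≈ g ]
    x-y≈g : [ x - y ≈ g ] ≡ 1
    x-y≈g = ⟦⟧-yes ((elem x - elem y) ≈? g) (AbelianGroup.refl G)

  𝒟≤k*k : ∀ j l g → 𝒟 j l g ≤ k j * k l
  𝒟≤k*k j l g = begin
    𝒟 j l g                                           ≤⟨ ∑-mono-≤ (λ x → *-monoʳ-≤ [ x ∈ A j ] (∑-mono-≤ (row≤ x))) ⟩
    ∑[ x < n ] ([ x ∈ A j ] * ∑[ y < n ] [ y ∈ A l ]) ≡⟨ sum-cong-≗ (λ x → cong ([ x ∈ A j ] *_) (∑[∈]≡k l)) ⟩
    ∑[ x < n ] ([ x ∈ A j ] * k l)                    ≡⟨ *-distribʳ-sum (k l) (λ x → [ x ∈ A j ]) ⟨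
    ∑[ x < n ] [ x ∈ A j ] * k l                      ≡⟨ cong (_* k l) (∑[∈]≡k j) ⟩
    k j * k l                                         ∎
    where
    open ≤-Reasoning
    row≤ : ∀ x y → [ y ∈ A l ] * [ x - y ≈ g ] ≤ [ y ∈ A l ]
    row≤ x y = *⟦⟧≤ [ y ∈ A l ] ((elem x - elem y) ≈? g)

  λ≤k*[K∸k] : ∀ i {g} → ¬ g ≈ ε → λ' i ≤ k i * (Σ[ k ] ∸ k i)
  λ≤k*[K∸k] i {g} g≉ε = begin
    λ' i                                   ≡⟨ ∑𝒟≡λ i g≉ε ⟨
    ∑[ l < m ] ([ l ≢ i ] * 𝒟 i l g)       ≤⟨ ∑-mono-≤ (λ l → *-monoʳ-≤ [ l ≢ i ] (𝒟≤k*k i l g)) ⟩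
    ∑[ l < m ] ([ l ≢ i ] * (k i * k l))   ≡⟨ sum-cong-≗ (λ l → x*[y*z]≡y*[x*z] [ l ≢ i ] (k i) (k l)) ⟩
    ∑[ l < m ] (k i * ([ l ≢ i ] * k l))   ≡⟨ *-distribˡ-sum (k i) (λ l → [ l ≢ i ] * k l) ⟨
    k i * ∑[ l < m ] ([ l ≢ i ] * k l)     ≡⟨ cong (k i *_) (∑[≢]k≡K∸k i) ⟩
    k i * (Σ[ k ] ∸ k i)                   ∎
    where open ≤-Reasoning

  ∑≢∑∈-const : ∀ i c → ∑[ l < m ] ([ l ≢ i ] * ∑[ b < n ] ([ b ∈ A l ] * c)) ≡ (Σ[ k ] ∸ k i) * c
  ∑≢∑∈-const i c = begin
    ∑[ l < m ] ([ l ≢ i ] * ∑[ b < n ] ([ b ∈ A l ] * c))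
      ≡⟨ sum-cong-≗ (λ l → cong ([ l ≢ i ] *_) (∑[∈]*c l)) ⟩
    ∑[ l < m ] ([ l ≢ i ] * (k l * c))   ≡⟨ sum-cong-≗ (λ l → *-assoc [ l ≢ i ] (k l) c) ⟨
    ∑[ l < m ] ([ l ≢ i ] * k l * c)     ≡⟨ *-distribʳ-sum c (λ l → [ l ≢ i ] * k l) ⟨
    ∑[ l < m ] ([ l ≢ i ] * k l) * c     ≡⟨ cong (_* c) (∑[≢]k≡K∸k i) ⟩
    (Σ[ k ] ∸ k i) * c                   ∎
    where
    open ≡-Reasoning
    ∑[∈]*c : ∀ l → ∑[ b < n ] ([ b ∈ A l ] * c) ≡ k l * c
    ∑[∈]*c l = trans (sym (*-distribʳ-sum c (λ b → [ b ∈ A l ]))) (cong (_* c) (∑[∈]≡k l))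

  K∸k>0 : ∀ i → 0 < λ' i → 1 < k i → 0 < Σ[ k ] ∸ k i
  K∸k>0 i λ>0 k>1 =
    let a , a∈ = ∃-∈ i (<-trans z<s k>1)
        a' , a'≢a = ∃-≢ a∈ k>1
    in proj₂ (*-pos-inv (k i) (Σ[ k ] ∸ k i) (<-≤-trans λ>0 (λ≤k*[K∸k] i (-≉ε a'≢a))))

  module _ (i : Fin m) where

    𝒳 : Carrier → ℕ
    𝒳 d = ∑[ l < m ] ([ l ≢ i ] * ∑[ j < m ] (([ j ≢ i ] * [ j ≢ l ]) * 𝒟 l j d))

    λ-split : ∀ {l d} → l ≢ i → ¬ d ≈ ε → λ' l ≡ 𝒟 l i d + ∑[ j < m ] (([ j ≢ i ] * [ j ≢ l ]) * 𝒟 l j d)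
    λ-split {l} {d} l≢i d≉ε = begin
      λ' l                                                              ≡⟨ ∑𝒟≡λ l d≉ε ⟨
      ∑[ j < m ] ([ j ≢ l ] * 𝒟 l j d)                                  ≡⟨ ∑-split (λ j → [ j ≢ l ] * 𝒟 l j d) i ⟩
      [ i ≢ l ] * 𝒟 l i d + ∑[ j < m ] ([ j ≢ i ] * ([ j ≢ l ] * 𝒟 l j d))
        ≡⟨ cong₂ _+_ (trans (cong (_* 𝒟 l i d) (⟦⟧-yes (¬? (i ≟ l)) (l≢i ∘ sym))) (*-identityˡ (𝒟 l i d)))
                     (sum-cong-≗ (λ j → sym (*-assoc [ j ≢ i ] [ j ≢ l ] (𝒟 l j d)))) ⟩
      𝒟 l i d + ∑[ j < m ] (([ j ≢ i ] * [ j ≢ l ]) * 𝒟 l j d)         ∎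
      where open ≡-Reasoning

    Λ≡2λ+𝒳 : ∀ {d} → ¬ d ≈ ε → Σ[ λ' ] ≡ 2 * λ' i + 𝒳 d
    Λ≡2λ+𝒳 {d} d≉ε = begin
      Σ[ λ' ]                                              ≡⟨ Σ[]≡∑ λ' ⟩
      sum λ'                                               ≡⟨ ∑-split λ' i ⟩
      λ' i + ∑[ l < m ] ([ l ≢ i ] * λ' l)
        ≡⟨ cong (λ' i +_) (∑-cong-supp (λ l → [ l ≢ i ]) λ' (λ l → 𝒟 l i d + rest l)
                                        (λ l l≢i → λ-split ([≢]>0⇒≢ l≢i) d≉ε)) ⟩
      λ' i + ∑[ l < m ] ([ l ≢ i ] * (𝒟 l i d + rest l))
        ≡⟨ cong (λ' i +_) (sum-cong-≗ (λ l → *-distribˡ-+ [ l ≢ i ] (𝒟 l i d) (rest l))) ⟩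
      λ' i + ∑[ l < m ] ([ l ≢ i ] * 𝒟 l i d + [ l ≢ i ] * rest l)
        ≡⟨ cong (λ' i +_) (∑-distrib-+ (λ l → [ l ≢ i ] * 𝒟 l i d) (λ l → [ l ≢ i ] * rest l)) ⟩
      λ' i + (∑[ l < m ] ([ l ≢ i ] * 𝒟 l i d) + 𝒳 d)      ≡⟨ cong (λ t → λ' i + (t + 𝒳 d)) ∑𝒟[-i]≡λ ⟩
      λ' i + (λ' i + 𝒳 d)                                  ≡⟨ +-assoc (λ' i) (λ' i) (𝒳 d) ⟨
      λ' i + λ' i + 𝒳 d                                    ≡⟨ cong (λ t → λ' i + t + 𝒳 d) (+-identityʳ (λ' i)) ⟨
      2 * λ' i + 𝒳 d                                       ∎
      where
      open ≡-Reasoning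
      rest : Fin m → ℕ
      rest l = ∑[ j < m ] (([ j ≢ i ] * [ j ≢ l ]) * 𝒟 l j d)
      ∑𝒟[-i]≡λ : ∑[ l < m ] ([ l ≢ i ] * 𝒟 l i d) ≡ λ' i
      ∑𝒟[-i]≡λ = trans (sum-cong-≗ (λ l → cong ([ l ≢ i ] *_) (𝒟-swap l i d))) (∑𝒟≡λ i (⁻¹-≉ε G d≉ε))

    𝒳≡Λ∸2λ : ∀ {d} → ¬ d ≈ ε → 𝒳 d ≡ Σ[ λ' ] ∸ 2 * λ' i
    𝒳≡Λ∸2λ d≉ε = sym (trans (cong (_∸ 2 * λ' i) (Λ≡2λ+𝒳 d≉ε)) (m+n∸m≡n (2 * λ' i) _))

    𝒩 : Fin m → Fin n → Carrier → ℕ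
    𝒩 l b d = ∑[ j < m ] (([ j ≢ i ] * [ j ≢ l ]) * ∑[ c < n ] ([ c ∈ A j ] * [ b - c ≈ d ]))

    𝒳≡∑𝒩 : ∀ d → 𝒳 d ≡ ∑[ l < m ] ([ l ≢ i ] * ∑[ b < n ] ([ b ∈ A l ] * 𝒩 l b d))
    𝒳≡∑𝒩 d = sum-cong-≗ λ l → cong ([ l ≢ i ] *_)
      (∑-*-comm (λ j → [ j ≢ i ] * [ j ≢ l ]) (λ b → [ b ∈ A l ]) (λ j b → ∑[ c < n ] ([ c ∈ A j ] * [ b - c ≈ d ])))

    module _ {a : Fin n} (a∈ : a ∈ A i) where

      [∈A∖a] : Fin n → ℕ
      [∈A∖a] a' = [ a' ≢ a ] * [ a' ∈ A i ]

      𝒯 : ℕ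
      𝒯 = ∑[ a' < n ] ([∈A∖a] a' * 𝒳 (elem a - elem a'))

      𝒯≡ : 𝒯 ≡ (k i ∸ 1) * (Σ[ λ' ] ∸ 2 * λ' i)
      𝒯≡ = begin
        𝒯                                 ≡⟨ ∑-cong-supp [∈A∖a] (λ a' → 𝒳 (elem a - elem a')) (λ _ → κ) 𝒳≡κ ⟩
        ∑[ a' < n ] ([∈A∖a] a' * κ)       ≡⟨ *-distribʳ-sum κ [∈A∖a] ⟨
        ∑[ a' < n ] [∈A∖a] a' * κ         ≡⟨ cong (_* κ) (∑[≢∈]≡k∸1 a∈) ⟩
        (k i ∸ 1) * κ                     ∎
        where
        open ≡-Reasoning
        κ = Σ[ λ' ] ∸ 2 * λ' i
        𝒳≡κ : ∀ a' → 0 < [∈A∖a] a' → 𝒳 (elem a - elem a') ≡ κ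
        𝒳≡κ a' pos = 𝒳≡Λ∸2λ (-≉ε (≢-sym ([≢]>0⇒≢ (proj₁ (*-pos-inv [ a' ≢ a ] [ a' ∈ A i ] pos)))))

      completions<λ : ∀ {l b} → l ≢ i → b ∈ A l → ∑[ a' < n ] ([∈A∖a] a' * 𝒩 l b (elem a - elem a')) < λ' i
      completions<λ {l} {b} l≢i b∈ = begin-strict
        ∑[ a' < n ] ([∈A∖a] a' * 𝒩 l b (elem a - elem a'))
          ≡⟨ ∑-*-comm [∈A∖a] (λ j → [ j ≢ i ] * [ j ≢ l ]) R ⟩
        ∑[ j < m ] (([ j ≢ i ] * [ j ≢ l ]) * ∑[ a' < n ] ([∈A∖a] a' * R a' j))
          <⟨ ∑-mono-< l summand≤ summand< ⟩
        ∑[ j < m ] ([ j ≢ i ] * 𝒟 i j (elem a - elem b))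
          ≡⟨ ∑𝒟≡λ i (-≉ε a≢b) ⟩
        λ' i ∎
        where
        open ≤-Reasoning
        R : Fin n → Fin m → ℕ
        R a' j = ∑[ c < n ] ([ c ∈ A j ] * [ b - c ≈ elem a - elem a' ])
        a≢b : a ≢ b
        a≢b refl = disjoint i l (l≢i ∘ sym) a a∈ b∈
        summand≤ : ∀ j → ([ j ≢ i ] * [ j ≢ l ]) * ∑[ a' < n ] ([∈A∖a] a' * R a' j) ≤ [ j ≢ i ] * 𝒟 i j (elem a - elem b)
        summand≤ j = *-mono-≤ (*⟦⟧≤ [ j ≢ i ] (¬? (j ≟ l)))
          (∑-mono-≤ λ a' → *-mono-≤ (⟦⟧*≤ (¬? (a' ≟ a)) [ a' ∈ A i ])
            (∑-mono-≤ λ c → *-monoʳ-≤ [ c ∈ A j ]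
              (⟦⟧-mono ((elem b - elem c) ≈? (elem a - elem a')) ((elem a' - elem c) ≈? (elem a - elem b)) (-‿exchange G))))
        -- The j = l summand is empty on the left, while on the right it contains (a, b).
        summand< : ([ l ≢ i ] * [ l ≢ l ]) * ∑[ a' < n ] ([∈A∖a] a' * R a' l) < [ l ≢ i ] * 𝒟 i l (elem a - elem b)
        summand< = begin-strict
          ([ l ≢ i ] * [ l ≢ l ]) * Y ≡⟨ cong (λ t → [ l ≢ i ] * t * Y) ([≢]-refl l) ⟩
          ([ l ≢ i ] * 0) * Y         ≡⟨ cong (_* Y) (*-zeroʳ [ l ≢ i ]) ⟩
          0                           <⟨ 𝒟-pos a∈ b∈ ⟩
          D                           ≡⟨ *-identityˡ D ⟨
          1 * D                       ≡⟨ cong (_* D) (⟦⟧-yes (¬? (l ≟ i)) l≢i) ⟨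
          [ l ≢ i ] * D               ∎
          where
          Y = ∑[ a' < n ] ([∈A∖a] a' * R a' l)
          D = 𝒟 i l (elem a - elem b)

      𝒯≤ : 𝒯 ≤ (Σ[ k ] ∸ k i) * (λ' i ∸ 1)
      𝒯≤ = begin
        𝒯
          ≡⟨ sum-cong-≗ (λ a' → cong ([∈A∖a] a' *_) (𝒳≡∑𝒩 (d a'))) ⟩
        ∑[ a' < n ] ([∈A∖a] a' * ∑[ l < m ] ([ l ≢ i ] * ∑[ b < n ] ([ b ∈ A l ] * 𝒩 l b (d a'))))
          ≡⟨ ∑-*-comm [∈A∖a] (λ l → [ l ≢ i ]) (λ a' l → ∑[ b < n ] ([ b ∈ A l ] * 𝒩 l b (d a'))) ⟩
        ∑[ l < m ] ([ l ≢ i ] * ∑[ a' < n ] ([∈A∖a] a' * ∑[ b < n ] ([ b ∈ A l ] * 𝒩 l b (d a'))))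
          ≡⟨ sum-cong-≗ (λ l → cong ([ l ≢ i ] *_) (∑-*-comm [∈A∖a] (λ b → [ b ∈ A l ]) (λ a' b → 𝒩 l b (d a')))) ⟩
        ∑[ l < m ] ([ l ≢ i ] * ∑[ b < n ] ([ b ∈ A l ] * ∑[ a' < n ] ([∈A∖a] a' * 𝒩 l b (d a'))))
          ≤⟨ ∑-mono-supp (λ l → [ l ≢ i ]) _ _ (λ l l≢i → ∑-mono-supp (λ b → [ b ∈ A l ]) _ _ (λ b b∈ →
               <⇒≤∸1 (completions<λ ([≢]>0⇒≢ l≢i) (⟦⟧>0⇒ (b ∈? A l) b∈)))) ⟩
        ∑[ l < m ] ([ l ≢ i ] * ∑[ b < n ] ([ b ∈ A l ] * (λ' i ∸ 1)))
          ≡⟨ ∑≢∑∈-const i (λ' i ∸ 1) ⟩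
        (Σ[ k ] ∸ k i) * (λ' i ∸ 1) ∎
        where
        open ≤-Reasoning
        d : Fin n → Carrier
        d a' = elem a - elem a'

  [k∸1][Λ∸2λ]≤[K∸k][λ∸1] : ∀ i → 0 < k i → (k i ∸ 1) * (Σ[ λ' ] ∸ 2 * λ' i) ≤ (Σ[ k ] ∸ k i) * (λ' i ∸ 1)
  [k∸1][Λ∸2λ]≤[K∸k][λ∸1] i k>0 =
    let a , a∈ = ∃-∈ i k>0 in begin
      (k i ∸ 1) * (Σ[ λ' ] ∸ 2 * λ' i) ≡⟨ 𝒯≡ i a∈ ⟨
      𝒯 i a∈                           ≤⟨ 𝒯≤ i a∈ ⟩
      (Σ[ k ] ∸ k i) * (λ' i ∸ 1)      ∎
    where open ≤-Reasoning

theorem5p2 : {c ℓ : Level} {G : AbelianGroup c ℓ} {n : ℕ} (F : FiniteAbelianGroup G n)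
             (m : ℕ) → 3 ≤ m →
             (A : Fin m → Subset n) (k λ' : Fin m → ℕ) →
             IsGSEDF F m A k λ' →
             (i : Fin m) → λ' i < k i → 1 < λ' i → 2 * λ' i ≤ Σ[ λ' ] →
             (0 < (Σ[ k ] ∸ k i) * (λ' i ∸ 1))
             × ((k i ∸ 1) * (Σ[ λ' ] ∸ 2 * λ' i) ≤ (Σ[ k ] ∸ k i) * (λ' i ∸ 1))
theorem5p2 F m _ A k λ' H i λ<k 1<λ _ =
  *-mono-< (K∸k>0 i (<-trans z<s 1<λ) k>1) (m<n⇒0<n∸m 1<λ) , [k∸1][Λ∸2λ]≤[K∸k][λ∸1] i (<-trans z<s k>1)
  where
  open GSEDF F H
  k>1 : 1 < k i
  k>1 = <-trans 1<λ λ<k
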